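{- The circular clique $C_{6,2}$ is not invariant under any ordered partial Maltsev operation on its vertex set, i.e., there is no total order $\le$ on $D=\{0,1,\dots,5\}$ such that $C_{6,2}$ is invariant under $M_{D,\le}$.
   Context: $C_{6,2}$ is the graph with vertex set $\{0,1,\dots,5\}$ and edge set $\{ij\mid 2\le|i-j|\le4\}$, regarded as a symmetric digraph (arcs $(i,j)$ and $(j,i)$ for each edge). For a total order $\le$ on a finite set $D$, $M_{D,\le}$ is the ternary partial operation with $M_{D,\le}(x,y,y)=M_{D,\le}(y,y,x)=x$ whenever $x\le y$, undefined otherwise. A digraph is invariant under a partial operation if, whenever the operation applied coordinatewise to arcs is defined in both coordinates, the resulting pair is an arc. -}

module Defs where

open import Data.Nat using (ℕ; _≤_; _∸_; _+_)
open import Data.Fin using (Fin; toℕ)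
open import Data.Product using (_×_)
open import Data.Sum using (_⊎_)
open import Relation.Binary.PropositionalEquality using (_≡_)
open import Relation.Binary.Core using (Rel)
open import Level using (0ℓ)

dist : ℕ → ℕ → ℕ
dist i j = (i ∸ j) + (j ∸ i)

D : Set
D = Fin 6

Arc : D → D → Set
Arc i j = (2 ≤ dist (toℕ i) (toℕ j)) × (dist (toℕ i) (toℕ j) ≤ 4)

-- The ordered partial Maltsev operation M_{D,≤}, given by its graph:
-- MGraph _≼_ x y z w  means  M_{D,≼}(x,y,z) is defined and equals w.
MGraph : Rel D 0ℓ → D → D → D → D → Set
MGraph _≼_ x y z w =
  ((y ≡ z) × (x ≼ y) × (w ≡ x)) ⊎ ((x ≡ y) × (z ≼ x) × (w ≡ z))

Invariant : Rel D 0ℓ → Set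
Invariant _≼_ =
  ∀ {a₁ b₁ a₂ b₂ a₃ b₃ a b} →
  Arc a₁ b₁ → Arc a₂ b₂ → Arc a₃ b₃ →
  MGraph _≼_ a₁ a₂ a₃ a → MGraph _≼_ b₁ b₂ b₃ b →
  Arc a b

-- Any three pairwise adjacent vertices x, y, z of C_{6,2} (e.g. 0, 2, 4) have a
-- least element m; call the others a and b. Applying M coordinatewise to the arcs
-- (m,a), (b,a), (b,m) gives M(m,b,b) = m and M(a,a,m) = m, so invariance would
-- force the loop (m,m), which C_{6,2} does not have.
module Submission where

open import Defs
open import Relation.Nullary using (¬_)
open import Relation.Binary.Core using (Rel)
open import Relation.Binary.Structures using (IsTotalPreorder; IsTotalOrder)
open import Relation.Binary.PropositionalEquality using (_≡_; refl; subst)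
open import Level using (Level; 0ℓ)
open import Data.Nat using (_≤_; _∸_; z≤n; s≤s)
open import Data.Nat.Properties using (+-comm; n∸n≡0)
open import Data.Fin using (toℕ; #_)
open import Data.Product using (_×_; _,_)
open import Data.Sum using (_⊎_; inj₁; inj₂)
open import Data.Empty using (⊥)

dist-comm : ∀ i j → dist i j ≡ dist j i
dist-comm i j = +-comm (i ∸ j) (j ∸ i)

dist-self : ∀ i → dist i i ≡ 0
dist-self i rewrite n∸n≡0 i = refl

Arc-sym : ∀ i j → Arc i j → Arc j i
Arc-sym i j = subst (λ d → (2 ≤ d) × (d ≤ 4)) (dist-comm (toℕ i) (toℕ j))

Arc-irrefl : ∀ i → ¬ Arc i i
Arc-irrefl i (2≤d , _) with subst (2 ≤_) (dist-self (toℕ i)) 2≤d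
... | ()

module _ {a ℓ₁ ℓ₂ : Level} {A : Set a} {_≈_ : Rel A ℓ₁} {_≲_ : Rel A ℓ₂}
         (isTotalPreorder : IsTotalPreorder _≈_ _≲_) where
  open IsTotalPreorder isTotalPreorder using (total; trans)

  minimum-of-three : ∀ x y z →
    (x ≲ y × x ≲ z) ⊎ (y ≲ x × y ≲ z) ⊎ (z ≲ x × z ≲ y)
  minimum-of-three x y z with total x y | total x z | total y z
  ... | inj₁ x≲y | inj₁ x≲z | _        = inj₁ (x≲y , x≲z)
  ... | inj₁ x≲y | inj₂ z≲x | _        = inj₂ (inj₂ (z≲x , trans z≲x x≲y))
  ... | inj₂ y≲x | _        | inj₁ y≲z = inj₂ (inj₁ (y≲x , y≲z))
  ... | inj₂ y≲x | _        | inj₂ z≲y = inj₂ (inj₂ (trans z≲y y≲x , z≲y))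

Invariant⇒loop : ∀ {_≼_ : Rel D 0ℓ} {m a b} → Invariant _≼_ →
  Arc m a → Arc m b → Arc a b → m ≼ a → m ≼ b → Arc m m
Invariant⇒loop {m = m} {a} {b} inv ma mb ab m≼a m≼b =
  inv ma (Arc-sym a b ab) (Arc-sym m b mb) (inj₁ (refl , m≼b , refl)) (inj₂ (refl , m≼a , refl))

Invariant⇒triangle-free : ∀ {_≼_ : Rel D 0ℓ} → IsTotalPreorder _≡_ _≼_ → Invariant _≼_ →
  ∀ x y z → Arc x y → Arc x z → Arc y z → ⊥
Invariant⇒triangle-free tot inv x y z xy xz yz with minimum-of-three tot x y z
... | inj₁ (x≼y , x≼z)        = Arc-irrefl x (Invariant⇒loop inv xy xz yz x≼y x≼z)
... | inj₂ (inj₁ (y≼x , y≼z)) = Arc-irrefl y (Invariant⇒loop inv (Arc-sym x y xy) yz xz y≼x y≼z)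
... | inj₂ (inj₂ (z≼x , z≼y)) =
  Arc-irrefl z (Invariant⇒loop inv (Arc-sym x z xz) (Arc-sym y z yz) xy z≼x z≼y)

proposition59 : (_≼_ : Rel D 0ℓ) → IsTotalOrder _≡_ _≼_ → ¬ Invariant _≼_
proposition59 _≼_ tot inv =
  Invariant⇒triangle-free (IsTotalOrder.isTotalPreorder tot) inv (# 0) (# 2) (# 4)
    (s≤s (s≤s z≤n) , s≤s (s≤s z≤n))
    (s≤s (s≤s z≤n) , s≤s (s≤s (s≤s (s≤s z≤n))))
    (s≤s (s≤s z≤n) , s≤s (s≤s z≤n))
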